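{- Let $G$ be a finite simple undirected graph and $x\in V_G$. If $G$ has NLC-width $k$, then $\operatorname{nlcw}(LC(G,x))\le k+\min(k,\deg_G(x))$. If $G$ has clique-width $k$, then $\operatorname{cw}(LC(G,x))\le k+\min(2k,2\deg_G(x))$.
   Context: $\deg_G(x)=|N_G(x)|$ is the number of neighbors of $x$. Local complementation: $LC(G,x)$ has vertex set $V_G$ and is obtained from $G$ by replacing the subgraph induced by $N_G(x)$ by its edge complement: for distinct $y,z\in N_G(x)$, $\{y,z\}$ is an edge of $LC(G,x)$ iff it is not an edge of $G$; all other adjacencies are unchanged. Clique-width: for a positive integer $k$, $\mathrm{CW}_k$ is the smallest class of graphs whose vertices carry labels from $\{1,\dots,k\}$ that contains every single-vertex graph with any label and is closed under: disjoint union; relabeling $\rho_{a\to b}$ for $a\neq b$; and $\eta_{a,b}$ for $a\neq b$ (add all edges between vertices labeled $a$ and vertices labeled $b$). $\operatorname{cw}(G)$ is the least $k$ such that some labeling of $G$ lies in $\mathrm{CW}_k$. NLC-width: $\mathrm{NLC}_k$ is the smallest class of labeled graphs (labels in $\{1,\dots,k\}$) containing every single-vertex graph with any label and closed under: $G\times_S J$ for $S\subseteq\{1,\dots,k\}^2$ (disjoint union of vertex-disjoint $G$ and $J$ plus all edges $\{u,v\}$, $u\in V_G$, $v\in V_J$, $(\mathrm{lab}(u),\mathrm{lab}(v))\in S$); and $\circ_R$ for $R:\{1,\dots,k\}\to\{1,\dots,k\}$. $\operatorname{nlcw}(G)$ is the least $k$ such that some labeling of $G$ lies in $\mathrm{NLC}_k$.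 -}

module Defs where

open import Data.Nat using (ℕ; _≤_)
open import Data.Fin using (Fin; _≟_)
open import Data.Bool using (Bool; true; false; not; _∧_; if_then_else_; T)
open import Data.Bool.Properties using (∧-comm; ∧-zeroʳ)
open import Data.List using (length; filterᵇ; allFin)
open import Data.Unit using (⊤; tt)
open import Data.Empty using (⊥)
open import Data.Sum using (_⊎_; inj₁; inj₂)
open import Data.Product using (Σ; _×_; _,_)
open import Function.Bundles using (_↔_; _⇔_; Inverse)
open import Relation.Nullary using (does; yes; no; ¬_)
open import Relation.Binary.PropositionalEquality using (_≡_; _≢_; refl; sym; cong)

record Graph (n : ℕ) : Set where
  field
    adj    : Fin n → Fin n → Bool
    adj-sym : ∀ u v → adj u v ≡ adj v u
    irrefl : ∀ u → adj u u ≡ false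
open Graph public

deg : ∀ {n} → Graph n → Fin n → ℕ
deg G x = length (filterᵇ (adj G x) (allFin _))

private
  ≟-sym : ∀ {n} (y z : Fin n) → does (y ≟ z) ≡ does (z ≟ y)
  ≟-sym y z with y ≟ z | z ≟ y
  ... | yes _ | yes _ = refl
  ... | no _  | no _  = refl
  ... | yes p | no q  with q (sym p)
  ... | ()
  ≟-sym y z | no p | yes q with p (sym q)
  ... | ()

  ≟-refl : ∀ {n} (y : Fin n) → does (y ≟ y) ≡ true
  ≟-refl y with y ≟ y
  ... | yes _ = refl
  ... | no p with p refl
  ... | ()

lcCond : ∀ {n} → Graph n → Fin n → Fin n → Fin n → Bool
lcCond G x y z = (adj G x y ∧ adj G x z) ∧ not (does (y ≟ z))

lcAdj : ∀ {n} → Graph n → Fin n → Fin n → Fin n → Bool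
lcAdj G x y z = if lcCond G x y z then not (adj G y z) else adj G y z

private
  lcCond-sym : ∀ {n} (G : Graph n) x y z → lcCond G x y z ≡ lcCond G x z y
  lcCond-sym G x y z
    rewrite ∧-comm (adj G x y) (adj G x z) | ≟-sym y z = refl

  lcAdj-sym : ∀ {n} (G : Graph n) x y z → lcAdj G x y z ≡ lcAdj G x z y
  lcAdj-sym G x y z rewrite lcCond-sym G x y z | adj-sym G y z = refl

  lcAdj-irr : ∀ {n} (G : Graph n) x y → lcAdj G x y y ≡ false
  lcAdj-irr G x y
    rewrite ≟-refl y | ∧-zeroʳ (adj G x y ∧ adj G x y) = irrefl G y

LC : ∀ {n} → Graph n → Fin n → Graph n
LC G x = record
  { adj    = lcAdj G x
  ; adj-sym = lcAdj-sym G x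
  ; irrefl = lcAdj-irr G x
  }

data CWExpr (k : ℕ) : Set where
  cw-vert : Fin k → CWExpr k
  _cw-⊕_  : CWExpr k → CWExpr k → CWExpr k
  cw-ρ    : (a b : Fin k) → a ≢ b → CWExpr k → CWExpr k
  cw-η    : (a b : Fin k) → a ≢ b → CWExpr k → CWExpr k

CWV : ∀ {k} → CWExpr k → Set
CWV (cw-vert _)     = ⊤
CWV (e cw-⊕ f)      = CWV e ⊎ CWV f
CWV (cw-ρ _ _ _ e)  = CWV e
CWV (cw-η _ _ _ e)  = CWV e

cwLab : ∀ {k} (e : CWExpr k) → CWV e → Fin k
cwLab (cw-vert a)    _        = a
cwLab (e cw-⊕ f)     (inj₁ u) = cwLab e u
cwLab (e cw-⊕ f)     (inj₂ u) = cwLab f u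
cwLab (cw-ρ a b _ e) u        = if does (cwLab e u ≟ a) then b else cwLab e u
cwLab (cw-η _ _ _ e) u        = cwLab e u

cwEdge : ∀ {k} (e : CWExpr k) → CWV e → CWV e → Set
cwEdge (cw-vert _)    _        _        = ⊥
cwEdge (e cw-⊕ f)     (inj₁ u) (inj₁ v) = cwEdge e u v
cwEdge (e cw-⊕ f)     (inj₁ u) (inj₂ v) = ⊥
cwEdge (e cw-⊕ f)     (inj₂ u) (inj₁ v) = ⊥
cwEdge (e cw-⊕ f)     (inj₂ u) (inj₂ v) = cwEdge f u v
cwEdge (cw-ρ _ _ _ e) u        v        = cwEdge e u v
cwEdge (cw-η a b _ e) u        v        =
  cwEdge e u v
  ⊎ ((cwLab e u ≡ a × cwLab e v ≡ b) ⊎ (cwLab e u ≡ b × cwLab e v ≡ a))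

HasCW : ∀ {n} → ℕ → Graph n → Set
HasCW {n} k G =
  Σ (CWExpr k) λ e → Σ (CWV e ↔ Fin n) λ f →
    ∀ u v → cwEdge e u v ⇔ T (adj G (Inverse.to f u) (Inverse.to f v))

CWWidth : ∀ {n} → Graph n → ℕ → Set
CWWidth G k = HasCW k G × (∀ j → HasCW j G → k ≤ j)

CW≤ : ∀ {n} → Graph n → ℕ → Set
CW≤ G m = Σ ℕ λ j → j ≤ m × HasCW j G

data NLCExpr (k : ℕ) : Set where
  nlc-vert : Fin k → NLCExpr k
  -- G ×_S J, with S ⊆ {1..k}² given by its characteristic function
  nlc-×    : (S : Fin k → Fin k → Bool) → NLCExpr k → NLCExpr k → NLCExpr k
  nlc-∘    : (R : Fin k → Fin k) → NLCExpr k → NLCExpr k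

NLCV : ∀ {k} → NLCExpr k → Set
NLCV (nlc-vert _)    = ⊤
NLCV (nlc-× _ e f)   = NLCV e ⊎ NLCV f
NLCV (nlc-∘ _ e)     = NLCV e

nlcLab : ∀ {k} (e : NLCExpr k) → NLCV e → Fin k
nlcLab (nlc-vert a)  _        = a
nlcLab (nlc-× _ e f) (inj₁ u) = nlcLab e u
nlcLab (nlc-× _ e f) (inj₂ u) = nlcLab f u
nlcLab (nlc-∘ R e)   u        = R (nlcLab e u)

nlcEdge : ∀ {k} (e : NLCExpr k) → NLCV e → NLCV e → Set
nlcEdge (nlc-vert _)  _        _        = ⊥
nlcEdge (nlc-× S e f) (inj₁ u) (inj₁ v) = nlcEdge e u v
nlcEdge (nlc-× S e f) (inj₁ u) (inj₂ v) = T (S (nlcLab e u) (nlcLab f v))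
nlcEdge (nlc-× S e f) (inj₂ v) (inj₁ u) = T (S (nlcLab e u) (nlcLab f v))
nlcEdge (nlc-× S e f) (inj₂ u) (inj₂ v) = nlcEdge f u v
nlcEdge (nlc-∘ _ e)   u        v        = nlcEdge e u v

HasNLC : ∀ {n} → ℕ → Graph n → Set
HasNLC {n} k G =
  Σ (NLCExpr k) λ e → Σ (NLCV e ↔ Fin n) λ f →
    ∀ u v → nlcEdge e u v ⇔ T (adj G (Inverse.to f u) (Inverse.to f v))

NLCWidth : ∀ {n} → Graph n → ℕ → Set
NLCWidth G k = HasNLC k G × (∀ j → HasNLC j G → k ≤ j)

NLC≤ : ∀ {n} → Graph n → ℕ → Set
NLC≤ G m = Σ ℕ λ j → j ≤ m × HasNLC j G

-- LC(G,x) is G with the adjacency of every pair of distinct neighbours of x toggled, so it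
-- suffices to turn an expression for G into one for G with the adjacency inside a marked vertex
-- set toggled.
--
-- NLC-width: a product ×_S can toggle the marked pairs it creates, provided the labels tell marked
-- vertices apart. Either each label gets a marked copy (k + k labels), or each of the d marked
-- vertices gets a private label (k + d labels), whose original label is recovered by locating its
-- vertex in the operand.
--
-- Clique-width: edges cannot be removed, so the translated η's never join two marked vertices,
-- and the marked pairs that are non-adjacent in G are joined separately. With private labels
-- (k + d) this happens at the very end. With three copies of the labels (k + 2k: unmarked, marked,
-- and marked vertices of the right operand of a union) it happens at the union separating the two
-- vertices: a marked pair is non-adjacent in G exactly when no later η joins their labels, and the
-- label pairs joined by later η's are passed down the expression as a relation P.
--
-- Each bound then uses the construction with fewer labels.

module Submission where

open import Defs
open import Data.Nat using (ℕ; _+_; _*_; _⊓_)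
open import Data.Fin using (Fin)
open import Data.Product using (_×_)

open import Data.Bool using (Bool; true; false; not; _∧_; _∨_; _xor_; if_then_else_; T)
open import Data.Bool.ListAction using (any)
open import Data.Bool.Properties
  using (∧-comm; ∧-identityʳ; ∧-zeroʳ; ∧-distribˡ-∨; ∨-identityʳ; ∨-assoc; ∨-idem; ∨-comm; T-∨; T-∧)
open import Data.Empty using (⊥-elim)
open import Data.Fin using (_≟_; join; splitAt)
open import Data.Fin.Properties using (splitAt-join; +↔⊎)
open import Data.List using (List; []; _∷_; [_]; _++_; map; find; filterᵇ; allFin; lookup; cartesianProduct)
open import Data.List.Membership.Propositional using (_∈_; lose)
open import Data.List.Membership.Propositional.Properties
  using (∈-++⁺ˡ; ∈-++⁺ʳ; ∈-map⁺; ∈-filter⁺; ∈-allFin; ∈-cartesianProduct⁺)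
open import Data.List.Relation.Unary.Any using (Any; here; there; index; satisfied)
open import Data.List.Relation.Unary.Any.Properties using (lookup-index; any⇔)
open import Data.Maybe using (Maybe; just; nothing; is-just)
import Data.Maybe as Maybe
import Data.Maybe.Properties as Maybe
open import Data.Nat using (_≤?_)
open import Data.Nat.Properties
  using (+-monoʳ-≤; *-monoʳ-≤; ≤-refl; ≤-reflexive; ≤-trans; m≤m+n; +-identityʳ
        ; m≤n⇒m⊓n≡m; m≥n⇒m⊓n≡n; ⊓-glb; ≰⇒≥; ≰⇒>; <⇒≤)
open import Data.Product using (Σ; _,_; proj₁)
open import Data.Sum using (_⊎_; inj₁; inj₂; [_,_]′; reduce)
import Data.Sum as Sum
open import Data.Sum.Function.Propositional using (_⊎-↔_; _⊎-⇔_)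
open import Data.Sum.Properties using (inj₁-injective; inj₂-injective)
open import Data.Unit using (tt)
open import Function using (_∘_; const; _on_)
open import Function.Bundles using (_↔_; _⇔_; Inverse; Equivalence; Injection; mk⇔)
open import Function.Construct.Composition using (_⇔-∘_)
open import Function.Construct.Identity using (⇔-id)
open import Function.Construct.Symmetry using (⇔-sym)
open import Function.Properties.Inverse using (↔-refl; ↔-sym; ↔-trans; ↔⇒↣)
open import Relation.Binary.PropositionalEquality hiding ([_])
open import Relation.Nullary using (¬_; Dec; yes; no; does)
open import Relation.Nullary.Decidable using (dec-true; dec-false; T?; _×-dec_; _⊎-dec_)

open Inverse using (to; from)

T-injective : ∀ {a b} → (T a ⇔ T b) → a ≡ b
T-injective {false} {false} _ = refl
T-injective {false} {true}  a⇔b = ⊥-elim (Equivalence.from a⇔b tt)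
T-injective {true}  {false} a⇔b = ⊥-elim (Equivalence.to a⇔b tt)
T-injective {true}  {true}  _ = refl

T-does : ∀ {A : Set} (d : Dec A) → T (does d) ⇔ A
T-does (yes a)  = mk⇔ (const a) (const tt)
T-does (no ¬a) = mk⇔ (λ ()) ¬a

T-not-does : ∀ {A : Set} (d : Dec A) → T (not (does d)) ⇔ (¬ A)
T-not-does (yes a)  = mk⇔ (λ ()) (λ ¬a → ¬a a)
T-not-does (no ¬a) = mk⇔ (const ¬a) (const tt)

if-then-not≡xor : ∀ b c → (if b then not c else c) ≡ c xor b
if-then-not≡xor false false = refl
if-then-not≡xor false true  = refl
if-then-not≡xor true  false = refl
if-then-not≡xor true  true  = refl

not∧∨∧not≡xor : ∀ M E → (not M ∧ E) ∨ (M ∧ not E) ≡ E xor M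
not∧∨∧not≡xor false false = refl
not∧∨∧not≡xor false true  = refl
not∧∨∧not≡xor true  false = refl
not∧∨∧not≡xor true  true  = refl

if-not-∨-false≡xor : ∀ M E → (if M then not (E ∨ false) else E) ≡ E xor M
if-not-∨-false≡xor false false = refl
if-not-∨-false≡xor false true  = refl
if-not-∨-false≡xor true  false = refl
if-not-∨-false≡xor true  true  = refl

onBoth : ∀ {A : Set} → (A → A → Bool) → Maybe A → Maybe A → Bool
onBoth R (just a) (just b) = R a b
onBoth R _        _        = false

onBoth-nothingʳ : ∀ {A : Set} (R : A → A → Bool) x → onBoth R x nothing ≡ false
onBoth-nothingʳ R (just _) = refl
onBoth-nothingʳ R nothing  = refl

_∪_ : ∀ {A : Set} → (A → A → Bool) → (A → A → Bool) → A → A → Bool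
(R ∪ R′) x y = R x y ∨ R′ x y

is-inj₂ : ∀ {A B : Set} → A ⊎ B → Bool
is-inj₂ = [ const false , const true ]′

map₁-idem : ∀ {A B : Set} (f : A → A) → (∀ a → f (f a) ≡ f a) →
            ∀ (x : A ⊎ B) → Sum.map₁ f (Sum.map₁ f x) ≡ Sum.map₁ f x
map₁-idem f f-idem (inj₁ a) = cong inj₁ (f-idem a)
map₁-idem f f-idem (inj₂ _) = refl

lcAdj-xor : ∀ {n} (G : Graph n) x {y z} → y ≢ z →
            lcAdj G x y z ≡ adj G y z xor (adj G x y ∧ adj G x z)
lcAdj-xor G x {y} {z} y≢z
  rewrite dec-false (y ≟ z) y≢z | ∧-identityʳ (adj G x y ∧ adj G x z) =
  if-then-not≡xor (adj G x y ∧ adj G x z) (adj G y z)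

Realizes : ∀ {n} {V : Set} → (V → V → Bool) → Graph n → Set
Realizes {n} {V} edge G =
  Σ (V ↔ Fin n) λ f → ∀ u v → edge u v ≡ adj G (to f u) (to f v)

realizes-LC : ∀ {n} {V W : Set} {edge : V → V → Bool} {edge′ : W → W → Bool} (G : Graph n) x
  (f : V ↔ Fin n) → (∀ u v → edge u v ≡ adj G (to f u) (to f v)) →
  (mark : V → Bool) → (∀ u → mark u ≡ adj G x (to f u)) →
  (φ : V ↔ W) → (∀ w → edge′ w w ≡ false) →
  (∀ {u v} → u ≢ v → edge′ (to φ u) (to φ v) ≡ edge u v xor (mark u ∧ mark v)) →
  Realizes edge′ (LC G x)
realizes-LC {edge = edge} {edge′} G x f f-edge mark mark-adj φ edge′-irrefl edge′-xor = ↔-trans (↔-sym φ) f , edges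
  where
  lc-edge : ∀ u v → Dec (to f u ≡ to f v) → edge′ (to φ u) (to φ v) ≡ lcAdj G x (to f u) (to f v)
  lc-edge u v (yes fu≡fv) rewrite Injection.injective (↔⇒↣ f) fu≡fv =
    trans (edge′-irrefl _) (sym (irrefl (LC G x) (to f v)))
  lc-edge u v (no fu≢fv) = begin
    edge′ (to φ u) (to φ v)                              ≡⟨ edge′-xor (fu≢fv ∘ cong (to f)) ⟩
    edge u v xor (mark u ∧ mark v)                       ≡⟨ cong₂ (λ a b → edge u v xor (a ∧ b)) (mark-adj u) (mark-adj v) ⟩
    edge u v xor (adj G x (to f u) ∧ adj G x (to f v))   ≡⟨ cong (_xor _) (f-edge u v) ⟩
    adj G (to f u) (to f v) xor _                        ≡⟨ sym (lcAdj-xor G x fu≢fv) ⟩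
    lcAdj G x (to f u) (to f v)                          ∎
    where open ≡-Reasoning

  edges : ∀ w w′ → edge′ w w′ ≡ lcAdj G x (to f (from φ w)) (to f (from φ w′))
  edges w w′ = trans (sym (cong₂ edge′ (Inverse.strictlyInverseˡ φ w) (Inverse.strictlyInverseˡ φ w′)))
                     (lc-edge (from φ w) (from φ w′) (_ ≟ _))

-- Private indices for the neighbours of x

IndexInjective : ∀ {V : Set} {d} → (V → Maybe (Fin d)) → Set
IndexInjective τ = ∀ {u v i} → τ u ≡ just i → τ v ≡ just i → u ≡ v

IndexInjective-inj₁ : ∀ {A B : Set} {d} {τ : A ⊎ B → Maybe (Fin d)} → IndexInjective τ → IndexInjective (τ ∘ inj₁)
IndexInjective-inj₁ τ-inj p q = inj₁-injective (τ-inj p q)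

IndexInjective-inj₂ : ∀ {A B : Set} {d} {τ : A ⊎ B → Maybe (Fin d)} → IndexInjective τ → IndexInjective (τ ∘ inj₂)
IndexInjective-inj₂ τ-inj p q = inj₂-injective (τ-inj p q)

IndexInjective-∘ : ∀ {V W : Set} {d} {τ : W → Maybe (Fin d)} → IndexInjective τ →
                   (f : V ↔ W) → IndexInjective (τ ∘ to f)
IndexInjective-∘ τ-inj f p q = Injection.injective (↔⇒↣ f) (τ-inj p q)

module _ {V : Set} {d} (τ : V → Maybe (Fin d)) where

  locate : List V → Fin d → Maybe V
  locate vs i = find (λ u → Maybe.≡-dec _≟_ (τ u) (just i)) vs

  locate-complete : IndexInjective τ → ∀ {vs u i} → u ∈ vs → τ u ≡ just i → locate vs i ≡ just u
  locate-complete τ-inj {w ∷ vs} {u} {i} u∈w∷vs τu≡i with Maybe.≡-dec _≟_ (τ w) (just i)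
  ... | yes τw≡i = cong just (τ-inj τw≡i τu≡i)
  ... | no τw≢i with u∈w∷vs
  ...   | here refl = ⊥-elim (τw≢i τu≡i)
  ...   | there u∈vs = locate-complete τ-inj u∈vs τu≡i

indexLabel : ∀ {k d} → Fin k → Maybe (Fin d) → Fin k ⊎ Fin d
indexLabel c nothing  = inj₁ c
indexLabel c (just i) = inj₂ i

is-inj₂-indexLabel : ∀ {k d} (c : Fin k) (i : Maybe (Fin d)) → is-inj₂ (indexLabel c i) ≡ is-just i
is-inj₂-indexLabel c nothing  = refl
is-inj₂-indexLabel c (just i) = refl

map₁-indexLabel : ∀ {k d} (R : Fin k → Fin k) c (i : Maybe (Fin d)) →
                  Sum.map₁ R (indexLabel c i) ≡ indexLabel (R c) i
map₁-indexLabel R c nothing  = refl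
map₁-indexLabel R c (just i) = refl

module _ {k d} {V : Set} (lab : V → Fin k) (τ : V → Maybe (Fin d)) (vs : List V) where

  originalLabel : Fin k ⊎ Fin d → Maybe (Fin k)
  originalLabel (inj₁ c) = just c
  originalLabel (inj₂ i) = Maybe.map lab (locate τ vs i)

  originalLabel-indexLabel : IndexInjective τ → ∀ {u} → u ∈ vs →
                             originalLabel (indexLabel (lab u) (τ u)) ≡ just (lab u)
  originalLabel-indexLabel τ-inj {u} u∈vs with τ u in τu
  ... | nothing = refl
  ... | just i  = cong (Maybe.map lab) (locate-complete τ τ-inj u∈vs τu)

neighbourPosition : ∀ {n} (G : Graph n) x {y} → T (adj G x y) → Fin (deg G x)
neighbourPosition G x {y} xy = index (∈-filter⁺ (T? ∘ adj G x) (∈-allFin y) xy)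

neighbourPosition-injective : ∀ {n} (G : Graph n) x {y z} (xy : T (adj G x y)) (xz : T (adj G x z)) →
                              neighbourPosition G x xy ≡ neighbourPosition G x xz → y ≡ z
neighbourPosition-injective G x {y} {z} xy xz same = begin
  y                                    ≡⟨ lookup-index (∈-filter⁺ (T? ∘ adj G x) (∈-allFin y) xy) ⟩
  lookup neighbours (neighbourPosition G x xy) ≡⟨ cong (lookup neighbours) same ⟩
  lookup neighbours (neighbourPosition G x xz) ≡⟨ sym (lookup-index (∈-filter⁺ (T? ∘ adj G x) (∈-allFin z) xz)) ⟩
  z                                    ∎
  where
  open ≡-Reasoning
  neighbours = filterᵇ (adj G x) (allFin _)

positionIf : ∀ {n} (G : Graph n) x {y} → Dec (T (adj G x y)) → Maybe (Fin (deg G x))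
positionIf G x (yes xy) = just (neighbourPosition G x xy)
positionIf G x (no _)   = nothing

neighbourIndex : ∀ {n} (G : Graph n) x → Fin n → Maybe (Fin (deg G x))
neighbourIndex G x y = positionIf G x (T? (adj G x y))

neighbourIndex-is-just : ∀ {n} (G : Graph n) x y → is-just (neighbourIndex G x y) ≡ adj G x y
neighbourIndex-is-just G x y = is-just-positionIf (T? (adj G x y))
  where
  is-just-positionIf : (d : Dec (T (adj G x y))) → is-just (positionIf G x d) ≡ does d
  is-just-positionIf (yes _) = refl
  is-just-positionIf (no _)  = refl

neighbourIndex-injective : ∀ {n} (G : Graph n) x → IndexInjective (neighbourIndex G x)
neighbourIndex-injective G x {y} {z} = positionIf-injective (T? (adj G x y)) (T? (adj G x z))
  where
  positionIf-injective : ∀ {i} (dy : Dec (T (adj G x y))) (dz : Dec (T (adj G x z))) →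
                         positionIf G x dy ≡ just i → positionIf G x dz ≡ just i → y ≡ z
  positionIf-injective (yes xy) (yes xz) refl same = neighbourPosition-injective G x xy xz (sym (Maybe.just-injective same))

-- NLC-width

nlcAdj : ∀ {k} (e : NLCExpr k) → NLCV e → NLCV e → Bool
nlcAdj (nlc-vert _)  _        _        = false
nlcAdj (nlc-× S e f) (inj₁ u) (inj₁ v) = nlcAdj e u v
nlcAdj (nlc-× S e f) (inj₁ u) (inj₂ v) = S (nlcLab e u) (nlcLab f v)
nlcAdj (nlc-× S e f) (inj₂ v) (inj₁ u) = S (nlcLab e u) (nlcLab f v)
nlcAdj (nlc-× S e f) (inj₂ u) (inj₂ v) = nlcAdj f u v
nlcAdj (nlc-∘ _ e)   u        v        = nlcAdj e u v

nlcEdge⇔T : ∀ {k} (e : NLCExpr k) u v → nlcEdge e u v ⇔ T (nlcAdj e u v)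
nlcEdge⇔T (nlc-vert _)  _        _        = ⇔-id _
nlcEdge⇔T (nlc-× S e f) (inj₁ u) (inj₁ v) = nlcEdge⇔T e u v
nlcEdge⇔T (nlc-× S e f) (inj₁ u) (inj₂ v) = ⇔-id _
nlcEdge⇔T (nlc-× S e f) (inj₂ u) (inj₁ v) = ⇔-id _
nlcEdge⇔T (nlc-× S e f) (inj₂ u) (inj₂ v) = nlcEdge⇔T f u v
nlcEdge⇔T (nlc-∘ _ e)   u        v        = nlcEdge⇔T e u v

nlcAdj-irrefl : ∀ {k} (e : NLCExpr k) u → nlcAdj e u u ≡ false
nlcAdj-irrefl (nlc-vert _)  _        = refl
nlcAdj-irrefl (nlc-× _ e f) (inj₁ u) = nlcAdj-irrefl e u
nlcAdj-irrefl (nlc-× _ e f) (inj₂ u) = nlcAdj-irrefl f u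
nlcAdj-irrefl (nlc-∘ _ e)   u        = nlcAdj-irrefl e u

HasNLC⇒Realizes : ∀ {n k} (G : Graph n) → HasNLC k G → Σ (NLCExpr k) λ e → Realizes (nlcAdj e) G
HasNLC⇒Realizes G (e , f , e-edge) = e , f , λ u v → T-injective (e-edge u v ⇔-∘ ⇔-sym (nlcEdge⇔T e u v))

Realizes⇒HasNLC : ∀ {n k} (G : Graph n) (e : NLCExpr k) → Realizes (nlcAdj e) G → HasNLC k G
Realizes⇒HasNLC G e (f , e-edge) = e , f , λ u v → subst (λ b → _ ⇔ T b) (e-edge u v) (nlcEdge⇔T e u v)

nlcVertices : ∀ {k} (e : NLCExpr k) → List (NLCV e)
nlcVertices (nlc-vert _)  = [ tt ]
nlcVertices (nlc-× _ e f) = map inj₁ (nlcVertices e) ++ map inj₂ (nlcVertices f)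
nlcVertices (nlc-∘ _ e)   = nlcVertices e

∈-nlcVertices : ∀ {k} (e : NLCExpr k) u → u ∈ nlcVertices e
∈-nlcVertices (nlc-vert _)  tt       = here refl
∈-nlcVertices (nlc-× _ e f) (inj₁ u) = ∈-++⁺ˡ (∈-map⁺ inj₁ (∈-nlcVertices e u))
∈-nlcVertices (nlc-× _ e f) (inj₂ u) = ∈-++⁺ʳ (map inj₁ (nlcVertices e)) (∈-map⁺ inj₂ (∈-nlcVertices f u))
∈-nlcVertices (nlc-∘ _ e)   u        = ∈-nlcVertices e u

markLabel : ∀ {k} → Bool → Fin k → Fin k ⊎ Fin k
markLabel false = inj₁
markLabel true  = inj₂

doubledS : ∀ {k} → (Fin k → Fin k → Bool) → Fin k ⊎ Fin k → Fin k ⊎ Fin k → Bool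
doubledS S x y = S (reduce x) (reduce y) xor (is-inj₂ x ∧ is-inj₂ y)

doubledS-markLabel : ∀ {k} (S : Fin k → Fin k → Bool) b c b′ c′ →
                     doubledS S (markLabel b c) (markLabel b′ c′) ≡ S c c′ xor (b ∧ b′)
doubledS-markLabel S false c false c′ = refl
doubledS-markLabel S false c true  c′ = refl
doubledS-markLabel S true  c false c′ = refl
doubledS-markLabel S true  c true  c′ = refl

map-markLabel : ∀ {k} (R : Fin k → Fin k) b c → Sum.map R R (markLabel b c) ≡ markLabel b (R c)
map-markLabel R false c = refl
map-markLabel R true  c = refl

nlcDoubled : ∀ {k} (e : NLCExpr k) → (NLCV e → Bool) → NLCExpr (k + k)
nlcDoubled {k} (nlc-vert a)  m = nlc-vert (join k k (markLabel (m tt) a))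
nlcDoubled {k} (nlc-× S e f) m =
  nlc-× (λ l l′ → doubledS S (splitAt k l) (splitAt k l′)) (nlcDoubled e (m ∘ inj₁)) (nlcDoubled f (m ∘ inj₂))
nlcDoubled {k} (nlc-∘ R e)   m = nlc-∘ (join k k ∘ Sum.map R R ∘ splitAt k) (nlcDoubled e m)

nlcDoubled-vertices : ∀ {k} (e : NLCExpr k) m → NLCV e ↔ NLCV (nlcDoubled e m)
nlcDoubled-vertices (nlc-vert _)  m = ↔-refl
nlcDoubled-vertices (nlc-× _ e f) m = nlcDoubled-vertices e (m ∘ inj₁) ⊎-↔ nlcDoubled-vertices f (m ∘ inj₂)
nlcDoubled-vertices (nlc-∘ _ e)   m = nlcDoubled-vertices e m

nlcDoubled-label : ∀ {k} (e : NLCExpr k) m u →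
  nlcLab (nlcDoubled e m) (to (nlcDoubled-vertices e m) u) ≡ join k k (markLabel (m u) (nlcLab e u))
nlcDoubled-label     (nlc-vert a)  m tt       = refl
nlcDoubled-label     (nlc-× S e f) m (inj₁ u) = nlcDoubled-label e (m ∘ inj₁) u
nlcDoubled-label     (nlc-× S e f) m (inj₂ u) = nlcDoubled-label f (m ∘ inj₂) u
nlcDoubled-label {k} (nlc-∘ R e)   m u
  rewrite nlcDoubled-label e m u | splitAt-join k k (markLabel (m u) (nlcLab e u)) =
  cong (join k k) (map-markLabel R (m u) (nlcLab e u))

nlcDoubled-edge : ∀ {k} (e : NLCExpr k) m {u v} → u ≢ v →
  nlcAdj (nlcDoubled e m) (to (nlcDoubled-vertices e m) u) (to (nlcDoubled-vertices e m) v) ≡ nlcAdj e u v xor (m u ∧ m v)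
nlcDoubled-edge (nlc-vert _) m {tt} {tt} u≢v = ⊥-elim (u≢v refl)
nlcDoubled-edge (nlc-× S e f) m {inj₁ u} {inj₁ v} u≢v = nlcDoubled-edge e (m ∘ inj₁) (u≢v ∘ cong inj₁)
nlcDoubled-edge (nlc-× S e f) m {inj₂ u} {inj₂ v} u≢v = nlcDoubled-edge f (m ∘ inj₂) (u≢v ∘ cong inj₂)
nlcDoubled-edge {k} (nlc-× S e f) m {inj₁ u} {inj₂ v} _
  rewrite nlcDoubled-label e (m ∘ inj₁) u | nlcDoubled-label f (m ∘ inj₂) v
        | splitAt-join k k (markLabel (m (inj₁ u)) (nlcLab e u))
        | splitAt-join k k (markLabel (m (inj₂ v)) (nlcLab f v)) =
  doubledS-markLabel S (m (inj₁ u)) (nlcLab e u) (m (inj₂ v)) (nlcLab f v)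
nlcDoubled-edge (nlc-× S e f) m {inj₂ u} {inj₁ v} _ =
  trans (nlcDoubled-edge (nlc-× S e f) m {inj₁ v} {inj₂ u} (λ ()))
        (cong (S (nlcLab e v) (nlcLab f u) xor_) (∧-comm (m (inj₁ v)) (m (inj₂ u))))
nlcDoubled-edge (nlc-∘ R e) m u≢v = nlcDoubled-edge e m u≢v

nlcOriginalLabel : ∀ {k d} (e : NLCExpr k) → (NLCV e → Maybe (Fin d)) → Fin k ⊎ Fin d → Maybe (Fin k)
nlcOriginalLabel e τ = originalLabel (nlcLab e) τ (nlcVertices e)

indexedS : ∀ {k d} → (Fin k → Fin k → Bool) → (origˡ origʳ : Fin k ⊎ Fin d → Maybe (Fin k)) →
           Fin k ⊎ Fin d → Fin k ⊎ Fin d → Bool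
indexedS S origˡ origʳ x y = onBoth S (origˡ x) (origʳ y) xor (is-inj₂ x ∧ is-inj₂ y)

nlcIndexed : ∀ {k d} (e : NLCExpr k) → (NLCV e → Maybe (Fin d)) → NLCExpr (k + d)
nlcIndexed {k} {d} (nlc-vert a)  τ = nlc-vert (join k d (indexLabel a (τ tt)))
nlcIndexed {k} {d} (nlc-× S e f) τ =
  nlc-× (λ l l′ → indexedS S (nlcOriginalLabel e (τ ∘ inj₁)) (nlcOriginalLabel f (τ ∘ inj₂))
                           (splitAt k l) (splitAt k l′))
        (nlcIndexed e (τ ∘ inj₁)) (nlcIndexed f (τ ∘ inj₂))
nlcIndexed {k} {d} (nlc-∘ R e)   τ = nlc-∘ (join k d ∘ Sum.map₁ R ∘ splitAt k) (nlcIndexed e τ)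

nlcIndexed-vertices : ∀ {k d} (e : NLCExpr k) (τ : NLCV e → Maybe (Fin d)) → NLCV e ↔ NLCV (nlcIndexed e τ)
nlcIndexed-vertices (nlc-vert _)  τ = ↔-refl
nlcIndexed-vertices (nlc-× _ e f) τ = nlcIndexed-vertices e (τ ∘ inj₁) ⊎-↔ nlcIndexed-vertices f (τ ∘ inj₂)
nlcIndexed-vertices (nlc-∘ _ e)   τ = nlcIndexed-vertices e τ

nlcIndexed-label : ∀ {k d} (e : NLCExpr k) (τ : NLCV e → Maybe (Fin d)) u →
  nlcLab (nlcIndexed e τ) (to (nlcIndexed-vertices e τ) u) ≡ join k d (indexLabel (nlcLab e u) (τ u))
nlcIndexed-label         (nlc-vert a)  τ tt       = refl
nlcIndexed-label         (nlc-× S e f) τ (inj₁ u) = nlcIndexed-label e (τ ∘ inj₁) u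
nlcIndexed-label         (nlc-× S e f) τ (inj₂ u) = nlcIndexed-label f (τ ∘ inj₂) u
nlcIndexed-label {k} {d} (nlc-∘ R e)   τ u
  rewrite nlcIndexed-label e τ u | splitAt-join k d (indexLabel (nlcLab e u) (τ u)) =
  cong (join k d) (map₁-indexLabel R (nlcLab e u) (τ u))

indexedS-indexLabel : ∀ {k d} (S : Fin k → Fin k → Bool) (e f : NLCExpr k) τ σ →
  IndexInjective τ → IndexInjective σ → ∀ u v →
  indexedS {d = d} S (nlcOriginalLabel e τ) (nlcOriginalLabel f σ)
                     (indexLabel (nlcLab e u) (τ u)) (indexLabel (nlcLab f v) (σ v))
  ≡ S (nlcLab e u) (nlcLab f v) xor (is-just (τ u) ∧ is-just (σ v))
indexedS-indexLabel S e f τ σ τ-inj σ-inj u v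
  rewrite originalLabel-indexLabel (nlcLab e) τ (nlcVertices e) τ-inj (∈-nlcVertices e u)
        | originalLabel-indexLabel (nlcLab f) σ (nlcVertices f) σ-inj (∈-nlcVertices f v)
        | is-inj₂-indexLabel (nlcLab e u) (τ u) | is-inj₂-indexLabel (nlcLab f v) (σ v) = refl

nlcIndexed-edge : ∀ {k d} (e : NLCExpr k) (τ : NLCV e → Maybe (Fin d)) → IndexInjective τ → ∀ {u v} → u ≢ v →
  nlcAdj (nlcIndexed e τ) (to (nlcIndexed-vertices e τ) u) (to (nlcIndexed-vertices e τ) v)
  ≡ nlcAdj e u v xor (is-just (τ u) ∧ is-just (τ v))
nlcIndexed-edge (nlc-vert _) τ τ-inj {tt} {tt} u≢v = ⊥-elim (u≢v refl)
nlcIndexed-edge (nlc-× S e f) τ τ-inj {inj₁ u} {inj₁ v} u≢v =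
  nlcIndexed-edge e (τ ∘ inj₁) (IndexInjective-inj₁ τ-inj) (u≢v ∘ cong inj₁)
nlcIndexed-edge (nlc-× S e f) τ τ-inj {inj₂ u} {inj₂ v} u≢v =
  nlcIndexed-edge f (τ ∘ inj₂) (IndexInjective-inj₂ τ-inj) (u≢v ∘ cong inj₂)
nlcIndexed-edge {k} {d} (nlc-× S e f) τ τ-inj {inj₁ u} {inj₂ v} _
  rewrite nlcIndexed-label e (τ ∘ inj₁) u | nlcIndexed-label f (τ ∘ inj₂) v
        | splitAt-join k d (indexLabel (nlcLab e u) (τ (inj₁ u)))
        | splitAt-join k d (indexLabel (nlcLab f v) (τ (inj₂ v))) =
  indexedS-indexLabel S e f _ _ (IndexInjective-inj₁ τ-inj) (IndexInjective-inj₂ τ-inj) u v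
nlcIndexed-edge (nlc-× S e f) τ τ-inj {inj₂ u} {inj₁ v} _ =
  trans (nlcIndexed-edge (nlc-× S e f) τ τ-inj {inj₁ v} {inj₂ u} (λ ()))
        (cong (S (nlcLab e v) (nlcLab f u) xor_) (∧-comm (is-just (τ (inj₁ v))) (is-just (τ (inj₂ u)))))
nlcIndexed-edge (nlc-∘ R e) τ τ-inj u≢v = nlcIndexed-edge e τ τ-inj u≢v

-- Clique-width

Joins : ∀ {m} → Fin m → Fin m → Fin m → Fin m → Set
Joins a b c c′ = (c ≡ a × c′ ≡ b) ⊎ (c ≡ b × c′ ≡ a)

joins? : ∀ {m} (a b c c′ : Fin m) → Dec (Joins a b c c′)
joins? a b c c′ = (c ≟ a ×-dec c′ ≟ b) ⊎-dec (c ≟ b ×-dec c′ ≟ a)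

joins : ∀ {m} → Fin m → Fin m → Fin m → Fin m → Bool
joins a b c c′ = does (joins? a b c c′)

joins-sym : ∀ {m} (a b c c′ : Fin m) → joins a b c c′ ≡ joins a b c′ c
joins-sym a b c c′ =
  T-injective (⇔-sym (T-does (joins? a b c′ c)) ⇔-∘ (mk⇔ swap swap ⇔-∘ T-does (joins? a b c c′)))
  where
  swap : ∀ {x y} → Joins a b x y → Joins a b y x
  swap (inj₁ (x≡a , y≡b)) = inj₂ (y≡b , x≡a)
  swap (inj₂ (x≡b , y≡a)) = inj₁ (y≡a , x≡b)

joins-irrefl : ∀ {m} {a b : Fin m} → a ≢ b → ∀ c → joins a b c c ≡ false
joins-irrefl a≢b c = dec-false (joins? _ _ c c) λ
  { (inj₁ (c≡a , c≡b)) → a≢b (trans (sym c≡a) c≡b)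
  ; (inj₂ (c≡b , c≡a)) → a≢b (trans (sym c≡a) c≡b) }

cwAdj : ∀ {k} (e : CWExpr k) → CWV e → CWV e → Bool
cwAdj (cw-vert _)    _        _        = false
cwAdj (e cw-⊕ f)     (inj₁ u) (inj₁ v) = cwAdj e u v
cwAdj (e cw-⊕ f)     (inj₁ u) (inj₂ v) = false
cwAdj (e cw-⊕ f)     (inj₂ u) (inj₁ v) = false
cwAdj (e cw-⊕ f)     (inj₂ u) (inj₂ v) = cwAdj f u v
cwAdj (cw-ρ _ _ _ e) u        v        = cwAdj e u v
cwAdj (cw-η a b _ e) u        v        = cwAdj e u v ∨ joins a b (cwLab e u) (cwLab e v)

cwEdge⇔T : ∀ {k} (e : CWExpr k) u v → cwEdge e u v ⇔ T (cwAdj e u v)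
cwEdge⇔T (cw-vert _)    _        _        = mk⇔ (λ ()) (λ ())
cwEdge⇔T (e cw-⊕ f)     (inj₁ u) (inj₁ v) = cwEdge⇔T e u v
cwEdge⇔T (e cw-⊕ f)     (inj₁ u) (inj₂ v) = mk⇔ (λ ()) (λ ())
cwEdge⇔T (e cw-⊕ f)     (inj₂ u) (inj₁ v) = mk⇔ (λ ()) (λ ())
cwEdge⇔T (e cw-⊕ f)     (inj₂ u) (inj₂ v) = cwEdge⇔T f u v
cwEdge⇔T (cw-ρ _ _ _ e) u        v        = cwEdge⇔T e u v
cwEdge⇔T (cw-η a b _ e) u        v        =
  ⇔-sym T-∨ ⇔-∘ (cwEdge⇔T e u v ⊎-⇔ ⇔-sym (T-does (joins? a b (cwLab e u) (cwLab e v))))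

cwAdj-irrefl : ∀ {k} (e : CWExpr k) u → cwAdj e u u ≡ false
cwAdj-irrefl (cw-vert _)      _        = refl
cwAdj-irrefl (e cw-⊕ f)       (inj₁ u) = cwAdj-irrefl e u
cwAdj-irrefl (e cw-⊕ f)       (inj₂ u) = cwAdj-irrefl f u
cwAdj-irrefl (cw-ρ _ _ _ e)   u        = cwAdj-irrefl e u
cwAdj-irrefl (cw-η a b a≢b e) u        = cong₂ _∨_ (cwAdj-irrefl e u) (joins-irrefl a≢b (cwLab e u))

cwAdj-sym : ∀ {k} (e : CWExpr k) u v → cwAdj e u v ≡ cwAdj e v u
cwAdj-sym (cw-vert _)    _        _        = refl
cwAdj-sym (e cw-⊕ f)     (inj₁ u) (inj₁ v) = cwAdj-sym e u v
cwAdj-sym (e cw-⊕ f)     (inj₁ u) (inj₂ v) = refl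
cwAdj-sym (e cw-⊕ f)     (inj₂ u) (inj₁ v) = refl
cwAdj-sym (e cw-⊕ f)     (inj₂ u) (inj₂ v) = cwAdj-sym f u v
cwAdj-sym (cw-ρ _ _ _ e) u        v        = cwAdj-sym e u v
cwAdj-sym (cw-η a b _ e) u        v        = cong₂ _∨_ (cwAdj-sym e u v) (joins-sym a b (cwLab e u) (cwLab e v))

HasCW⇒Realizes : ∀ {n k} (G : Graph n) → HasCW k G → Σ (CWExpr k) λ e → Realizes (cwAdj e) G
HasCW⇒Realizes G (e , f , e-edge) = e , f , λ u v → T-injective (e-edge u v ⇔-∘ ⇔-sym (cwEdge⇔T e u v))

Realizes⇒HasCW : ∀ {n k} (G : Graph n) (e : CWExpr k) → Realizes (cwAdj e) G → HasCW k G
Realizes⇒HasCW G e (f , e-edge) = e , f , λ u v → subst (λ b → _ ⇔ T b) (e-edge u v) (cwEdge⇔T e u v)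

cwVertices : ∀ {k} (e : CWExpr k) → List (CWV e)
cwVertices (cw-vert _)    = [ tt ]
cwVertices (e cw-⊕ f)     = map inj₁ (cwVertices e) ++ map inj₂ (cwVertices f)
cwVertices (cw-ρ _ _ _ e) = cwVertices e
cwVertices (cw-η _ _ _ e) = cwVertices e

∈-cwVertices : ∀ {k} (e : CWExpr k) u → u ∈ cwVertices e
∈-cwVertices (cw-vert _)    tt       = here refl
∈-cwVertices (e cw-⊕ f)     (inj₁ u) = ∈-++⁺ˡ (∈-map⁺ inj₁ (∈-cwVertices e u))
∈-cwVertices (e cw-⊕ f)     (inj₂ u) = ∈-++⁺ʳ (map inj₁ (cwVertices e)) (∈-map⁺ inj₂ (∈-cwVertices f u))
∈-cwVertices (cw-ρ _ _ _ e) u        = ∈-cwVertices e u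
∈-cwVertices (cw-η _ _ _ e) u        = ∈-cwVertices e u

relabel : ∀ {m} → Fin m → Fin m → Fin m → Fin m
relabel a b c = if does (c ≟ a) then b else c

relabel-hit : ∀ {m} (a b : Fin m) → relabel a b a ≡ b
relabel-hit a b = cong (if_then b else a) (dec-true (a ≟ a) refl)

relabel-miss : ∀ {m} {a c : Fin m} b → c ≢ a → relabel a b c ≡ c
relabel-miss {a = a} {c} b c≢a = cong (if_then b else c) (dec-false (c ≟ a) c≢a)

relabel-trivial : ∀ {m} {a b : Fin m} → a ≡ b → ∀ c → relabel a b c ≡ c
relabel-trivial {a = a} {b} a≡b c with c ≟ a
... | yes c≡a = trans (sym a≡b) (sym c≡a)
... | no _    = refl

relabel-idem : ∀ {m} {a b : Fin m} → a ≢ b → ∀ c → relabel a b (relabel a b c) ≡ relabel a b c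
relabel-idem {a = a} {b} a≢b c with c ≟ a
... | yes _   = relabel-miss b (a≢b ∘ sym)
... | no c≢a  = relabel-miss b c≢a

module _ {m} (σ : Fin m → Fin m) where

  relabelSeq : List (Fin m) → Fin m → Fin m
  relabelSeq []       c = c
  relabelSeq (a ∷ as) c = relabelSeq as (relabel a (σ a) c)

  module _ (σ-idem : ∀ c → σ (σ c) ≡ σ c) where

    relabelSeq-fixed : ∀ as c → relabelSeq as (σ c) ≡ σ c
    relabelSeq-fixed []       c = refl
    relabelSeq-fixed (a ∷ as) c with σ c ≟ a
    ... | yes σc≡a = trans (cong (relabelSeq as) (trans (cong σ (sym σc≡a)) (σ-idem c))) (relabelSeq-fixed as c)
    ... | no σc≢a  = relabelSeq-fixed as c

    relabelSeq-∈ : ∀ {as c} → c ∈ as → relabelSeq as c ≡ σ c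
    relabelSeq-∈ {a ∷ as} (here refl) rewrite relabel-hit a (σ a) = relabelSeq-fixed as a
    relabelSeq-∈ {a ∷ as} {c} (there c∈as) with c ≟ a
    ... | yes refl = relabelSeq-fixed as c
    ... | no _     = relabelSeq-∈ c∈as

ρ-if : ∀ {m} (a b : Fin m) → Dec (a ≡ b) → CWExpr m → CWExpr m
ρ-if a b (yes _)   E = E
ρ-if a b (no a≢b) E = cw-ρ a b a≢b E

ρ-if-vertices : ∀ {m} (a b : Fin m) d E → CWV E ↔ CWV (ρ-if a b d E)
ρ-if-vertices a b (yes _) E = ↔-refl
ρ-if-vertices a b (no _)  E = ↔-refl

ρ-if-label : ∀ {m} (a b : Fin m) d E u →
             cwLab (ρ-if a b d E) (to (ρ-if-vertices a b d E) u) ≡ relabel a b (cwLab E u)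
ρ-if-label a b (yes a≡b) E u = sym (relabel-trivial a≡b (cwLab E u))
ρ-if-label a b (no _)    E u = refl

ρ-if-edge : ∀ {m} (a b : Fin m) d E u v →
            cwAdj (ρ-if a b d E) (to (ρ-if-vertices a b d E) u) (to (ρ-if-vertices a b d E) v) ≡ cwAdj E u v
ρ-if-edge a b (yes _) E u v = refl
ρ-if-edge a b (no _)  E u v = refl

module _ {m} (σ : Fin m → Fin m) where

  relabelList : List (Fin m) → CWExpr m → CWExpr m
  relabelList []       E = E
  relabelList (a ∷ as) E = relabelList as (ρ-if a (σ a) (a ≟ σ a) E)

  relabelList-vertices : ∀ as E → CWV E ↔ CWV (relabelList as E)
  relabelList-vertices []       E = ↔-refl
  relabelList-vertices (a ∷ as) E = ↔-trans (ρ-if-vertices a (σ a) (a ≟ σ a) E) (relabelList-vertices as _)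

  relabelList-label : ∀ as E u →
    cwLab (relabelList as E) (to (relabelList-vertices as E) u) ≡ relabelSeq σ as (cwLab E u)
  relabelList-label []       E u = refl
  relabelList-label (a ∷ as) E u =
    trans (relabelList-label as _ _) (cong (relabelSeq σ as) (ρ-if-label a (σ a) (a ≟ σ a) E u))

  relabelList-edge : ∀ as E u v →
    cwAdj (relabelList as E) (to (relabelList-vertices as E) u) (to (relabelList-vertices as E) v) ≡ cwAdj E u v
  relabelList-edge []       E u v = refl
  relabelList-edge (a ∷ as) E u v = trans (relabelList-edge as _ _ _) (ρ-if-edge a (σ a) (a ≟ σ a) E u v)

η-if : ∀ {m} → Bool → (a b : Fin m) → Dec (a ≡ b) → CWExpr m → CWExpr m
η-if true  a b (no a≢b) E = cw-η a b a≢b E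
η-if true  a b (yes _)  E = E
η-if false a b _        E = E

η-if-vertices : ∀ {m} j (a b : Fin m) d E → CWV E ↔ CWV (η-if j a b d E)
η-if-vertices true  a b (no _)  E = ↔-refl
η-if-vertices true  a b (yes _) E = ↔-refl
η-if-vertices false a b _       E = ↔-refl

η-if-label : ∀ {m} j (a b : Fin m) d E u → cwLab (η-if j a b d E) (to (η-if-vertices j a b d E) u) ≡ cwLab E u
η-if-label true  a b (no _)  E u = refl
η-if-label true  a b (yes _) E u = refl
η-if-label false a b _       E u = refl

η-if-edge : ∀ {m} j (a b : Fin m) d E u v →
  cwAdj (η-if j a b d E) (to (η-if-vertices j a b d E) u) (to (η-if-vertices j a b d E) v)
  ≡ cwAdj E u v ∨ (j ∧ not (does d) ∧ joins a b (cwLab E u) (cwLab E v))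
η-if-edge true  a b (no _)  E u v = refl
η-if-edge true  a b (yes _) E u v = sym (∨-identityʳ _)
η-if-edge false a b _       E u v = sym (∨-identityʳ _)

module _ {m} (J : Fin m → Fin m → Bool) where

  joinList : List (Fin m × Fin m) → CWExpr m → CWExpr m
  joinList []             E = E
  joinList ((a , b) ∷ ps) E = joinList ps (η-if (J a b) a b (a ≟ b) E)

  joinList-vertices : ∀ ps E → CWV E ↔ CWV (joinList ps E)
  joinList-vertices []             E = ↔-refl
  joinList-vertices ((a , b) ∷ ps) E = ↔-trans (η-if-vertices (J a b) a b (a ≟ b) E) (joinList-vertices ps _)

  joinList-label : ∀ ps E u → cwLab (joinList ps E) (to (joinList-vertices ps E) u) ≡ cwLab E u
  joinList-label []             E u = refl
  joinList-label ((a , b) ∷ ps) E u = trans (joinList-label ps _ _) (η-if-label (J a b) a b (a ≟ b) E u)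

  joinedBy : Fin m → Fin m → Fin m × Fin m → Bool
  joinedBy c c′ (a , b) = J a b ∧ not (does (a ≟ b)) ∧ joins a b c c′

  joinList-edge : ∀ ps E u v →
    cwAdj (joinList ps E) (to (joinList-vertices ps E) u) (to (joinList-vertices ps E) v)
    ≡ cwAdj E u v ∨ any (joinedBy (cwLab E u) (cwLab E v)) ps
  joinList-edge []             E u v = sym (∨-identityʳ _)
  joinList-edge ((a , b) ∷ ps) E u v = begin
    cwAdj (joinList ps E′) (to (joinList-vertices ps E′) u′) (to (joinList-vertices ps E′) v′)
      ≡⟨ joinList-edge ps E′ u′ v′ ⟩
    cwAdj E′ u′ v′ ∨ any (joinedBy (cwLab E′ u′) (cwLab E′ v′)) ps
      ≡⟨ cong₂ (λ x y → cwAdj E′ u′ v′ ∨ any (joinedBy x y) ps)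
               (η-if-label (J a b) a b (a ≟ b) E u) (η-if-label (J a b) a b (a ≟ b) E v) ⟩
    cwAdj E′ u′ v′ ∨ any (joinedBy (cwLab E u) (cwLab E v)) ps
      ≡⟨ cong (_∨ _) (η-if-edge (J a b) a b (a ≟ b) E u v) ⟩
    (cwAdj E u v ∨ joinedBy (cwLab E u) (cwLab E v) (a , b)) ∨ any (joinedBy (cwLab E u) (cwLab E v)) ps
      ≡⟨ ∨-assoc (cwAdj E u v) _ _ ⟩
    cwAdj E u v ∨ any (joinedBy (cwLab E u) (cwLab E v)) ((a , b) ∷ ps) ∎
    where
    open ≡-Reasoning
    E′ = η-if (J a b) a b (a ≟ b) E
    u′ = to (η-if-vertices (J a b) a b (a ≟ b) E) u
    v′ = to (η-if-vertices (J a b) a b (a ≟ b) E) v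

allPairs : ∀ m → List (Fin m × Fin m)
allPairs m = cartesianProduct (allFin m) (allFin m)

any-joinedBy : ∀ {m} (J : Fin m → Fin m → Bool) c c′ →
               any (joinedBy J c c′) (allPairs m) ≡ not (does (c ≟ c′)) ∧ (J c c′ ∨ J c′ c)
any-joinedBy {m} J c c′ = T-injective (mk⇔ from-any to-any ⇔-∘ ⇔-sym any⇔)
  where
  distinct-sym : ∀ {a b : Fin m} → T (not (does (a ≟ b))) → T (not (does (b ≟ a)))
  distinct-sym {a} {b} a≢b = Equivalence.from (T-not-does (b ≟ a)) (Equivalence.to (T-not-does (a ≟ b)) a≢b ∘ sym)

  joined⇒ : ∀ {a b} → T (J a b) → T (not (does (a ≟ b))) → Joins a b c c′ →
            T (not (does (c ≟ c′)) ∧ (J c c′ ∨ J c′ c))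
  joined⇒ {a} {b} Jab a≢b (inj₁ (refl , refl)) =
    Equivalence.from (T-∧ {not (does (a ≟ b))}) (a≢b , Equivalence.from (T-∨ {J a b}) (inj₁ Jab))
  joined⇒ {a} {b} Jab a≢b (inj₂ (refl , refl)) =
    Equivalence.from (T-∧ {not (does (b ≟ a))}) (distinct-sym {a} {b} a≢b , Equivalence.from (T-∨ {J b a}) (inj₂ Jab))

  from-any : Any (T ∘ joinedBy J c c′) (allPairs m) → T (not (does (c ≟ c′)) ∧ (J c c′ ∨ J c′ c))
  from-any p with satisfied p
  ... | (a , b) , t with Equivalence.to (T-∧ {J a b}) t
  ... | Jab , t′ with Equivalence.to (T-∧ {not (does (a ≟ b))}) t′
  ... | a≢b , ab = joined⇒ Jab a≢b (Equivalence.to (T-does (joins? a b c c′)) ab)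

  ⇒joined : ∀ {a b} → T (J a b) → T (not (does (a ≟ b))) → Joins a b c c′ →
            Any (T ∘ joinedBy J c c′) (allPairs m)
  ⇒joined {a} {b} Jab a≢b ab =
    lose (∈-cartesianProduct⁺ (∈-allFin a) (∈-allFin b))
         (Equivalence.from (T-∧ {J a b})
           (Jab , Equivalence.from (T-∧ {not (does (a ≟ b))}) (a≢b , Equivalence.from (T-does (joins? a b c c′)) ab)))

  to-any : T (not (does (c ≟ c′)) ∧ (J c c′ ∨ J c′ c)) → Any (T ∘ joinedBy J c c′) (allPairs m)
  to-any t with Equivalence.to (T-∧ {not (does (c ≟ c′))}) t
  ... | c≢c′ , t′ with Equivalence.to (T-∨ {J c c′}) t′
  ...   | inj₁ Jcc′ = ⇒joined Jcc′ c≢c′ (inj₁ (refl , refl))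
  ...   | inj₂ Jc′c = ⇒joined Jc′c (distinct-sym {c} {c′} c≢c′) (inj₂ (refl , refl))

module _ {m} {L : Set} (ι : Fin m ↔ L) where

  joinWhere : (L → L → Bool) → CWExpr m → CWExpr m
  joinWhere J = joinList (J on to ι) (allPairs m)

  joinWhere-vertices : ∀ J E → CWV E ↔ CWV (joinWhere J E)
  joinWhere-vertices J = joinList-vertices (J on to ι) (allPairs m)

  joinWhere-label : ∀ J E u → cwLab (joinWhere J E) (to (joinWhere-vertices J E) u) ≡ cwLab E u
  joinWhere-label J = joinList-label (J on to ι) (allPairs m)

  -- cw-η needs distinct labels, so two vertices with the same label are never joined.
  joinWhere-edge : ∀ J E {u v x y} → cwLab E u ≡ from ι x → cwLab E v ≡ from ι y →
    (x ≡ y → J x y ∨ J y x ≡ false) →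
    cwAdj (joinWhere J E) (to (joinWhere-vertices J E) u) (to (joinWhere-vertices J E) v) ≡ cwAdj E u v ∨ (J x y ∨ J y x)
  joinWhere-edge J E {u} {v} {x} {y} u↦x v↦y same⇒unjoined = begin
    cwAdj (joinWhere J E) (to (joinWhere-vertices J E) u) (to (joinWhere-vertices J E) v)
      ≡⟨ joinList-edge J′ (allPairs m) E u v ⟩
    cwAdj E u v ∨ any (joinedBy J′ (cwLab E u) (cwLab E v)) (allPairs m)
      ≡⟨ cong₂ (λ c c′ → cwAdj E u v ∨ any (joinedBy J′ c c′) (allPairs m)) u↦x v↦y ⟩
    cwAdj E u v ∨ any (joinedBy J′ (from ι x) (from ι y)) (allPairs m)
      ≡⟨ cong (cwAdj E u v ∨_) (any-joinedBy J′ (from ι x) (from ι y)) ⟩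
    cwAdj E u v ∨ (not (does (from ι x ≟ from ι y)) ∧ (J′ (from ι x) (from ι y) ∨ J′ (from ι y) (from ι x)))
      ≡⟨ cong₂ (λ x′ y′ → cwAdj E u v ∨ (_ ∧ (J x′ y′ ∨ J y′ x′)))
               (Inverse.strictlyInverseˡ ι x) (Inverse.strictlyInverseˡ ι y) ⟩
    cwAdj E u v ∨ (not (does (from ι x ≟ from ι y)) ∧ (J x y ∨ J y x))
      ≡⟨ cong (cwAdj E u v ∨_) (distinct (from ι x ≟ from ι y)) ⟩
    cwAdj E u v ∨ (J x y ∨ J y x) ∎
    where
    open ≡-Reasoning
    J′ = J on to ι
    distinct : (d : Dec (from ι x ≡ from ι y)) → not (does d) ∧ (J x y ∨ J y x) ≡ J x y ∨ J y x
    distinct (yes same) = sym (same⇒unjoined (Injection.injective (↔⇒↣ (↔-sym ι)) same))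
    distinct (no _)     = refl

  relabelBy : (L → L) → CWExpr m → CWExpr m
  relabelBy σ = relabelList (from ι ∘ σ ∘ to ι) (allFin m)

  relabelBy-vertices : ∀ σ E → CWV E ↔ CWV (relabelBy σ E)
  relabelBy-vertices σ = relabelList-vertices (from ι ∘ σ ∘ to ι) (allFin m)

  relabelBy-label : ∀ σ → (∀ x → σ (σ x) ≡ σ x) → ∀ E {u x} → cwLab E u ≡ from ι x →
                    cwLab (relabelBy σ E) (to (relabelBy-vertices σ E) u) ≡ from ι (σ x)
  relabelBy-label σ σ-idem E {u} {x} u↦x = begin
    cwLab (relabelBy σ E) (to (relabelBy-vertices σ E) u) ≡⟨ relabelList-label σ′ (allFin m) E u ⟩
    relabelSeq σ′ (allFin m) (cwLab E u)                  ≡⟨ cong (relabelSeq σ′ (allFin m)) u↦x ⟩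
    relabelSeq σ′ (allFin m) (from ι x)                   ≡⟨ relabelSeq-∈ σ′ σ′-idem (∈-allFin _) ⟩
    from ι (σ (to ι (from ι x)))                           ≡⟨ cong (from ι ∘ σ) (Inverse.strictlyInverseˡ ι x) ⟩
    from ι (σ x)                                           ∎
    where
    open ≡-Reasoning
    σ′ = from ι ∘ σ ∘ to ι
    σ′-idem : ∀ l → σ′ (σ′ l) ≡ σ′ l
    σ′-idem l = cong (from ι) (trans (cong σ (Inverse.strictlyInverseˡ ι (σ (to ι l)))) (σ-idem (to ι l)))

  relabelBy-edge : ∀ σ E u v →
    cwAdj (relabelBy σ E) (to (relabelBy-vertices σ E) u) (to (relabelBy-vertices σ E) v) ≡ cwAdj E u v
  relabelBy-edge σ = relabelList-edge (from ι ∘ σ ∘ to ι) (allFin m)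

module _ {k m} {L : Set} (ι : Fin m ↔ L) (isMarked : L → Bool) (origin : L → Maybe (Fin k)) (a b : Fin k) where

  unmarkedJoins : L → L → Bool
  unmarkedJoins x y = not (isMarked x ∧ isMarked y) ∧ onBoth (joins a b) (origin x) (origin y)

  unmarkedJoins-edge : a ≢ b → ∀ E {u v x y c c′} →
    cwLab E u ≡ from ι x → cwLab E v ≡ from ι y → origin x ≡ just c → origin y ≡ just c′ →
    cwAdj (joinWhere ι unmarkedJoins E) (to (joinWhere-vertices ι unmarkedJoins E) u)
                                        (to (joinWhere-vertices ι unmarkedJoins E) v)
    ≡ cwAdj E u v ∨ (not (isMarked x ∧ isMarked y) ∧ joins a b c c′)
  unmarkedJoins-edge a≢b E {x = x} {y} {c} {c′} u↦x v↦y x↦c y↦c′ =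
    trans (joinWhere-edge ι unmarkedJoins E u↦x v↦y unjoined-diagonal) (cong (cwAdj E _ _ ∨_) symmetric)
    where
    unjoined-diagonal : x ≡ y → unmarkedJoins x y ∨ unmarkedJoins y x ≡ false
    unjoined-diagonal refl rewrite x↦c | joins-irrefl a≢b c | ∧-zeroʳ (not (isMarked x ∧ isMarked x)) = refl

    symmetric : unmarkedJoins x y ∨ unmarkedJoins y x ≡ not (isMarked x ∧ isMarked y) ∧ joins a b c c′
    symmetric rewrite x↦c | y↦c′ | joins-sym a b c′ c | ∧-comm (isMarked y) (isMarked x) =
      ∨-idem (not (isMarked x ∧ isMarked y) ∧ joins a b c c′)

-- Clique-width with private labels

cwOriginalLabel : ∀ {k d} (e : CWExpr k) → (CWV e → Maybe (Fin d)) → Fin k ⊎ Fin d → Maybe (Fin k)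
cwOriginalLabel e τ = originalLabel (cwLab e) τ (cwVertices e)

cwIndexed : ∀ {k d} (e : CWExpr k) → (CWV e → Maybe (Fin d)) → CWExpr (k + d)
cwIndexed {k} {d} (cw-vert a)    τ = cw-vert (join k d (indexLabel a (τ tt)))
cwIndexed         (e cw-⊕ f)     τ = cwIndexed e (τ ∘ inj₁) cw-⊕ cwIndexed f (τ ∘ inj₂)
cwIndexed         (cw-ρ a b _ e) τ = relabelBy +↔⊎ (Sum.map₁ (relabel a b)) (cwIndexed e τ)
cwIndexed         (cw-η a b _ e) τ =
  joinWhere +↔⊎ (unmarkedJoins +↔⊎ is-inj₂ (cwOriginalLabel e τ) a b) (cwIndexed e τ)

cwIndexed-vertices : ∀ {k d} (e : CWExpr k) (τ : CWV e → Maybe (Fin d)) → CWV e ↔ CWV (cwIndexed e τ)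
cwIndexed-vertices (cw-vert _)    τ = ↔-refl
cwIndexed-vertices (e cw-⊕ f)     τ = cwIndexed-vertices e (τ ∘ inj₁) ⊎-↔ cwIndexed-vertices f (τ ∘ inj₂)
cwIndexed-vertices (cw-ρ a b _ e) τ =
  ↔-trans (cwIndexed-vertices e τ) (relabelBy-vertices +↔⊎ (Sum.map₁ (relabel a b)) (cwIndexed e τ))
cwIndexed-vertices (cw-η a b _ e) τ =
  ↔-trans (cwIndexed-vertices e τ)
          (joinWhere-vertices +↔⊎ (unmarkedJoins +↔⊎ is-inj₂ (cwOriginalLabel e τ) a b) (cwIndexed e τ))

cwIndexed-label : ∀ {k d} (e : CWExpr k) (τ : CWV e → Maybe (Fin d)) u →
  cwLab (cwIndexed e τ) (to (cwIndexed-vertices e τ) u) ≡ join k d (indexLabel (cwLab e u) (τ u))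
cwIndexed-label         (cw-vert a)      τ tt       = refl
cwIndexed-label         (e cw-⊕ f)       τ (inj₁ u) = cwIndexed-label e (τ ∘ inj₁) u
cwIndexed-label         (e cw-⊕ f)       τ (inj₂ u) = cwIndexed-label f (τ ∘ inj₂) u
cwIndexed-label {k} {d} (cw-ρ a b a≢b e) τ u =
  trans (relabelBy-label +↔⊎ (Sum.map₁ (relabel a b)) (map₁-idem (relabel a b) (relabel-idem a≢b)) (cwIndexed e τ)
                         {x = indexLabel (cwLab e u) (τ u)} (cwIndexed-label e τ u))
        (cong (join k d) (map₁-indexLabel (relabel a b) (cwLab e u) (τ u)))
cwIndexed-label         (cw-η a b _ e)   τ u =
  trans (joinWhere-label +↔⊎ (unmarkedJoins +↔⊎ is-inj₂ (cwOriginalLabel e τ) a b) (cwIndexed e τ) _)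
        (cwIndexed-label e τ u)

cwIndexed-edge : ∀ {k d} (e : CWExpr k) (τ : CWV e → Maybe (Fin d)) → IndexInjective τ → ∀ u v →
  cwAdj (cwIndexed e τ) (to (cwIndexed-vertices e τ) u) (to (cwIndexed-vertices e τ) v)
  ≡ not (is-just (τ u) ∧ is-just (τ v)) ∧ cwAdj e u v
cwIndexed-edge (cw-vert _) τ τ-inj tt tt = sym (∧-zeroʳ _)
cwIndexed-edge (e cw-⊕ f) τ τ-inj (inj₁ u) (inj₁ v) = cwIndexed-edge e (τ ∘ inj₁) (IndexInjective-inj₁ τ-inj) u v
cwIndexed-edge (e cw-⊕ f) τ τ-inj (inj₁ u) (inj₂ v) = sym (∧-zeroʳ _)
cwIndexed-edge (e cw-⊕ f) τ τ-inj (inj₂ u) (inj₁ v) = sym (∧-zeroʳ _)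
cwIndexed-edge (e cw-⊕ f) τ τ-inj (inj₂ u) (inj₂ v) = cwIndexed-edge f (τ ∘ inj₂) (IndexInjective-inj₂ τ-inj) u v
cwIndexed-edge (cw-ρ a b _ e) τ τ-inj u v =
  trans (relabelBy-edge +↔⊎ (Sum.map₁ (relabel a b)) (cwIndexed e τ) _ _) (cwIndexed-edge e τ τ-inj u v)
cwIndexed-edge (cw-η a b a≢b e) τ τ-inj u v = begin
  cwAdj (joinWhere +↔⊎ Jη E) (to (joinWhere-vertices +↔⊎ Jη E) u′) (to (joinWhere-vertices +↔⊎ Jη E) v′)
    ≡⟨ unmarkedJoins-edge +↔⊎ is-inj₂ (cwOriginalLabel e τ) a b a≢b E
         {x = indexLabel (cwLab e u) (τ u)} {y = indexLabel (cwLab e v) (τ v)} (cwIndexed-label e τ u) (cwIndexed-label e τ v)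
         (originalLabel-indexLabel (cwLab e) τ (cwVertices e) τ-inj (∈-cwVertices e u))
         (originalLabel-indexLabel (cwLab e) τ (cwVertices e) τ-inj (∈-cwVertices e v)) ⟩
  cwAdj E u′ v′ ∨ (not (is-inj₂ (indexLabel (cwLab e u) (τ u)) ∧ is-inj₂ (indexLabel (cwLab e v) (τ v)))
                   ∧ joins a b (cwLab e u) (cwLab e v))
    ≡⟨ cong₂ (λ x y → cwAdj E u′ v′ ∨ (not (x ∧ y) ∧ joins a b (cwLab e u) (cwLab e v)))
             (is-inj₂-indexLabel _ (τ u)) (is-inj₂-indexLabel _ (τ v)) ⟩
  cwAdj E u′ v′ ∨ (unmarked ∧ joins a b (cwLab e u) (cwLab e v))
    ≡⟨ cong (_∨ (unmarked ∧ joins a b (cwLab e u) (cwLab e v))) (cwIndexed-edge e τ τ-inj u v) ⟩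
  (unmarked ∧ cwAdj e u v) ∨ (unmarked ∧ joins a b (cwLab e u) (cwLab e v))
    ≡⟨ sym (∧-distribˡ-∨ unmarked _ _) ⟩
  unmarked ∧ (cwAdj e u v ∨ joins a b (cwLab e u) (cwLab e v)) ∎
  where
  open ≡-Reasoning
  E = cwIndexed e τ
  Jη = unmarkedJoins +↔⊎ is-inj₂ (cwOriginalLabel e τ) a b
  u′ = to (cwIndexed-vertices e τ) u
  v′ = to (cwIndexed-vertices e τ) v
  unmarked = not (is-just (τ u) ∧ is-just (τ v))

module _ {k d} (e : CWExpr k) (τ : CWV e → Maybe (Fin d)) where

  indexedVertex : Fin k ⊎ Fin d → Maybe (CWV e)
  indexedVertex (inj₁ _) = nothing
  indexedVertex (inj₂ i) = locate τ (cwVertices e) i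

  nonEdgeJoins : Fin k ⊎ Fin d → Fin k ⊎ Fin d → Bool
  nonEdgeJoins x y = onBoth (λ u v → not (cwAdj e u v)) (indexedVertex x) (indexedVertex y)

  cwComplementIndexed : CWExpr (k + d)
  cwComplementIndexed = joinWhere +↔⊎ nonEdgeJoins (cwIndexed e τ)

  cwComplementIndexed-vertices : CWV e ↔ CWV cwComplementIndexed
  cwComplementIndexed-vertices = ↔-trans (cwIndexed-vertices e τ) (joinWhere-vertices +↔⊎ nonEdgeJoins (cwIndexed e τ))

  module _ (τ-inj : IndexInjective τ) {u v : CWV e} (u≢v : u ≢ v) where

    private
      x = indexLabel (cwLab e u) (τ u)
      y = indexLabel (cwLab e v) (τ v)
      bothIndexed = is-just (τ u) ∧ is-just (τ v)

    nonEdgeJoins-indexLabel : nonEdgeJoins x y ∨ nonEdgeJoins y x ≡ bothIndexed ∧ not (cwAdj e u v)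
    nonEdgeJoins-indexLabel with τ u in τu | τ v in τv
    ... | nothing | w       = onBoth-nothingʳ _ (indexedVertex (indexLabel (cwLab e v) w))
    ... | just i  | nothing = trans (∨-identityʳ _) (onBoth-nothingʳ _ (locate τ (cwVertices e) i))
    ... | just i  | just j
      rewrite locate-complete τ τ-inj (∈-cwVertices e u) τu
            | locate-complete τ τ-inj (∈-cwVertices e v) τv
            | cwAdj-sym e v u = ∨-idem (not (cwAdj e u v))

    indexLabel≡⇒notBoth : x ≡ y → bothIndexed ≡ false
    indexLabel≡⇒notBoth x≡y with τ u in τu | τ v in τv
    ... | nothing | _       = refl
    ... | just i  | nothing = refl
    ... | just i  | just j  = ⊥-elim (u≢v (τ-inj τu (trans τv (cong just (sym (inj₂-injective x≡y))))))

    cwComplementIndexed-edge :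
      cwAdj cwComplementIndexed (to cwComplementIndexed-vertices u) (to cwComplementIndexed-vertices v)
      ≡ cwAdj e u v xor bothIndexed
    cwComplementIndexed-edge = begin
      cwAdj cwComplementIndexed (to cwComplementIndexed-vertices u) (to cwComplementIndexed-vertices v)
        ≡⟨ joinWhere-edge +↔⊎ nonEdgeJoins (cwIndexed e τ) {x = x} {y = y} (cwIndexed-label e τ u) (cwIndexed-label e τ v)
             (λ x≡y → trans nonEdgeJoins-indexLabel (cong (_∧ not (cwAdj e u v)) (indexLabel≡⇒notBoth x≡y))) ⟩
      cwAdj (cwIndexed e τ) _ _ ∨ (nonEdgeJoins x y ∨ nonEdgeJoins y x)
        ≡⟨ cong₂ _∨_ (cwIndexed-edge e τ τ-inj u v) nonEdgeJoins-indexLabel ⟩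
      (not bothIndexed ∧ cwAdj e u v) ∨ (bothIndexed ∧ not (cwAdj e u v))
        ≡⟨ not∧∨∧not≡xor bothIndexed (cwAdj e u v) ⟩
      cwAdj e u v xor bothIndexed ∎
      where open ≡-Reasoning

-- Clique-width with three copies of the labels

Tagged : ℕ → Set
Tagged k = Fin k ⊎ (Fin k ⊎ Fin k)

pattern plain  c = inj₁ c
pattern marked c = inj₂ (inj₁ c)
pattern parked c = inj₂ (inj₂ c)

tagLabels : ∀ k → Fin (k + (k + k)) ↔ Tagged k
tagLabels k = ↔-trans +↔⊎ (↔-refl ⊎-↔ +↔⊎)

module _ {k : ℕ} where

  tag : Bool → Fin k → Tagged k
  tag false c = plain c
  tag true  c = marked c

  isMarked : Tagged k → Bool
  isMarked (plain _)  = false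
  isMarked (marked _) = true
  isMarked (parked _) = false

  origin : Tagged k → Maybe (Fin k)
  origin (plain c)  = just c
  origin (marked c) = just c
  origin (parked _) = nothing

  mapOriginal : (Fin k → Fin k) → Tagged k → Tagged k
  mapOriginal σ (plain c)  = plain (σ c)
  mapOriginal σ (marked c) = marked (σ c)
  mapOriginal σ (parked c) = parked c

  park : Tagged k → Tagged k
  park (marked c) = parked c
  park x          = x

  unpark : Tagged k → Tagged k
  unpark (parked c) = marked c
  unpark x          = x

  crossJoins : (Fin k → Fin k → Bool) → Tagged k → Tagged k → Bool
  crossJoins P (marked c) (parked c′) = not (P c c′)
  crossJoins P _          _           = false

  isMarked-tag : ∀ b c → isMarked (tag b c) ≡ b
  isMarked-tag false c = refl
  isMarked-tag true  c = refl

  origin-tag : ∀ b c → origin (tag b c) ≡ just c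
  origin-tag false c = refl
  origin-tag true  c = refl

  mapOriginal-tag : ∀ σ b c → mapOriginal σ (tag b c) ≡ tag b (σ c)
  mapOriginal-tag σ false c = refl
  mapOriginal-tag σ true  c = refl

  mapOriginal-idem : ∀ σ → (∀ c → σ (σ c) ≡ σ c) → ∀ x → mapOriginal σ (mapOriginal σ x) ≡ mapOriginal σ x
  mapOriginal-idem σ σ-idem (plain c)  = cong plain (σ-idem c)
  mapOriginal-idem σ σ-idem (marked c) = cong marked (σ-idem c)
  mapOriginal-idem σ σ-idem (parked c) = refl

  park-idem : ∀ x → park (park x) ≡ park x
  park-idem (plain _)  = refl
  park-idem (marked _) = refl
  park-idem (parked _) = refl

  unpark-idem : ∀ x → unpark (unpark x) ≡ unpark x
  unpark-idem (plain _)  = refl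
  unpark-idem (marked _) = refl
  unpark-idem (parked _) = refl

  unpark-tag : ∀ b c → unpark (tag b c) ≡ tag b c
  unpark-tag false c = refl
  unpark-tag true  c = refl

  unpark-park-tag : ∀ b c → unpark (park (tag b c)) ≡ tag b c
  unpark-park-tag false c = refl
  unpark-park-tag true  c = refl

  crossJoins-irrefl : ∀ P x → crossJoins P x x ∨ crossJoins P x x ≡ false
  crossJoins-irrefl P (plain _)  = refl
  crossJoins-irrefl P (marked _) = refl
  crossJoins-irrefl P (parked _) = refl

  crossJoins-left : ∀ P b c b′ c′ → crossJoins P (tag b c) (tag b′ c′) ∨ crossJoins P (tag b′ c′) (tag b c) ≡ false
  crossJoins-left P false c false c′ = refl
  crossJoins-left P false c true  c′ = refl
  crossJoins-left P true  c false c′ = refl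
  crossJoins-left P true  c true  c′ = refl

  crossJoins-right : ∀ P b c b′ c′ →
    crossJoins P (park (tag b c)) (park (tag b′ c′)) ∨ crossJoins P (park (tag b′ c′)) (park (tag b c)) ≡ false
  crossJoins-right P false c false c′ = refl
  crossJoins-right P false c true  c′ = refl
  crossJoins-right P true  c false c′ = refl
  crossJoins-right P true  c true  c′ = refl

  crossJoins-across : ∀ P b c b′ c′ →
    crossJoins P (tag b c) (park (tag b′ c′)) ∨ crossJoins P (park (tag b′ c′)) (tag b c)
    ≡ (if b ∧ b′ then not (false ∨ P c c′) else false)
  crossJoins-across P false c false c′ = refl
  crossJoins-across P false c true  c′ = refl
  crossJoins-across P true  c false c′ = refl
  crossJoins-across P true  c true  c′ = ∨-identityʳ (not (P c c′))

-- P holds of the label pairs that the η's above e will join.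
cwTagged : ∀ {k} (e : CWExpr k) → (CWV e → Bool) → (Fin k → Fin k → Bool) → CWExpr (k + (k + k))
cwTagged {k} (cw-vert a)    m P = cw-vert (from (tagLabels k) (tag (m tt) a))
cwTagged {k} (e cw-⊕ f)     m P =
  relabelBy (tagLabels k) unpark
    (joinWhere (tagLabels k) (crossJoins P)
      (cwTagged e (m ∘ inj₁) P cw-⊕ relabelBy (tagLabels k) park (cwTagged f (m ∘ inj₂) P)))
cwTagged {k} (cw-ρ a b _ e) m P = relabelBy (tagLabels k) (mapOriginal (relabel a b)) (cwTagged e m (P on relabel a b))
cwTagged {k} (cw-η a b _ e) m P =
  joinWhere (tagLabels k) (unmarkedJoins (tagLabels k) isMarked origin a b) (cwTagged e m (P ∪ joins a b))

cwTagged-vertices : ∀ {k} (e : CWExpr k) m P → CWV e ↔ CWV (cwTagged e m P)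
cwTagged-vertices     (cw-vert a)    m P = ↔-refl
cwTagged-vertices {k} (e cw-⊕ f)     m P =
  ↔-trans (cwTagged-vertices e (m ∘ inj₁) P
             ⊎-↔ ↔-trans (cwTagged-vertices f (m ∘ inj₂) P) (relabelBy-vertices ι park right))
          (↔-trans (joinWhere-vertices ι (crossJoins P) (left cw-⊕ relabelBy ι park right))
                   (relabelBy-vertices ι unpark _))
  where
  ι = tagLabels k
  left = cwTagged e (m ∘ inj₁) P
  right = cwTagged f (m ∘ inj₂) P
cwTagged-vertices {k} (cw-ρ a b _ e) m P =
  ↔-trans (cwTagged-vertices e m (P on relabel a b)) (relabelBy-vertices (tagLabels k) (mapOriginal (relabel a b)) _)
cwTagged-vertices {k} (cw-η a b _ e) m P =
  ↔-trans (cwTagged-vertices e m (P ∪ joins a b))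
          (joinWhere-vertices (tagLabels k) (unmarkedJoins (tagLabels k) isMarked origin a b) _)

cwTagged-label : ∀ {k} (e : CWExpr k) m P u →
  cwLab (cwTagged e m P) (to (cwTagged-vertices e m P) u) ≡ from (tagLabels k) (tag (m u) (cwLab e u))
cwTagged-label     (cw-vert a)    m P tt = refl
cwTagged-label {k} (e cw-⊕ f)     m P (inj₁ u) =
  trans (relabelBy-label ι unpark unpark-idem _ {x = tag (m (inj₁ u)) (cwLab e u)}
          (trans (joinWhere-label ι (crossJoins P) _ _) (cwTagged-label e (m ∘ inj₁) P u)))
        (cong (from ι) (unpark-tag (m (inj₁ u)) (cwLab e u)))
  where ι = tagLabels k
cwTagged-label {k} (e cw-⊕ f)     m P (inj₂ u) =
  trans (relabelBy-label ι unpark unpark-idem _ {x = park (tag (m (inj₂ u)) (cwLab f u))}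
          (trans (joinWhere-label ι (crossJoins P) _ _)
                 (relabelBy-label ι park park-idem _ {x = tag (m (inj₂ u)) (cwLab f u)} (cwTagged-label f (m ∘ inj₂) P u))))
        (cong (from ι) (unpark-park-tag (m (inj₂ u)) (cwLab f u)))
  where ι = tagLabels k
cwTagged-label {k} (cw-ρ a b a≢b e) m P u =
  trans (relabelBy-label (tagLabels k) (mapOriginal (relabel a b)) (mapOriginal-idem (relabel a b) (relabel-idem a≢b)) _
          {x = tag (m u) (cwLab e u)} (cwTagged-label e m (P on relabel a b) u))
        (cong (from (tagLabels k)) (mapOriginal-tag (relabel a b) (m u) (cwLab e u)))
cwTagged-label {k} (cw-η a b _ e) m P u =
  trans (joinWhere-label (tagLabels k) (unmarkedJoins (tagLabels k) isMarked origin a b) _ _) (cwTagged-label e m _ u)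

TaggedEdges : ∀ {k} (e : CWExpr k) → (CWV e → Bool) → (Fin k → Fin k → Bool) → Set
TaggedEdges e m P = ∀ {u v} → u ≢ v →
  cwAdj (cwTagged e m P) (to (cwTagged-vertices e m P) u) (to (cwTagged-vertices e m P) v)
  ≡ (if m u ∧ m v then not (cwAdj e u v ∨ P (cwLab e u) (cwLab e v)) else cwAdj e u v)

cwTagged-edge-⊕ : ∀ {k} (e f : CWExpr k) m P → (∀ c c′ → P c c′ ≡ P c′ c) →
  TaggedEdges e (m ∘ inj₁) P → TaggedEdges f (m ∘ inj₂) P → TaggedEdges (e cw-⊕ f) m P
cwTagged-edge-⊕ {k} e f m P P-sym e-edge f-edge {u} {v} u≢v =
  trans (relabelBy-edge ι unpark X _ _)
        (trans (joinWhere-edge ι (crossJoins P) Y (labelY u) (labelY v) unjoined-diagonal) (union u v u≢v))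
  where
  ι = tagLabels k
  right = cwTagged f (m ∘ inj₂) P
  Y = cwTagged e (m ∘ inj₁) P cw-⊕ relabelBy ι park right
  X = joinWhere ι (crossJoins P) Y
  sides : CWV (e cw-⊕ f) ↔ CWV Y
  sides = cwTagged-vertices e (m ∘ inj₁) P
            ⊎-↔ ↔-trans (cwTagged-vertices f (m ∘ inj₂) P) (relabelBy-vertices ι park right)

  tagY : CWV (e cw-⊕ f) → Tagged k
  tagY (inj₁ w) = tag (m (inj₁ w)) (cwLab e w)
  tagY (inj₂ w) = park (tag (m (inj₂ w)) (cwLab f w))

  labelY : ∀ w → cwLab Y (to sides w) ≡ from ι (tagY w)
  labelY (inj₁ w) = cwTagged-label e (m ∘ inj₁) P w
  labelY (inj₂ w) =
    relabelBy-label ι park park-idem right {x = tag (m (inj₂ w)) (cwLab f w)} (cwTagged-label f (m ∘ inj₂) P w)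

  unjoined-diagonal : tagY u ≡ tagY v → crossJoins P (tagY u) (tagY v) ∨ crossJoins P (tagY v) (tagY u) ≡ false
  unjoined-diagonal same rewrite same = crossJoins-irrefl P (tagY v)

  union : ∀ u v → u ≢ v →
    cwAdj Y (to sides u) (to sides v) ∨ (crossJoins P (tagY u) (tagY v) ∨ crossJoins P (tagY v) (tagY u))
    ≡ (if m u ∧ m v then not (cwAdj (e cw-⊕ f) u v ∨ P (cwLab (e cw-⊕ f) u) (cwLab (e cw-⊕ f) v))
                    else cwAdj (e cw-⊕ f) u v)
  union (inj₁ u) (inj₁ v) u≢v
    rewrite crossJoins-left P (m (inj₁ u)) (cwLab e u) (m (inj₁ v)) (cwLab e v) =
    trans (∨-identityʳ _) (e-edge (u≢v ∘ cong inj₁))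
  union (inj₂ u) (inj₂ v) u≢v
    rewrite crossJoins-right P (m (inj₂ u)) (cwLab f u) (m (inj₂ v)) (cwLab f v) =
    trans (∨-identityʳ _) (trans (relabelBy-edge ι park right _ _) (f-edge (u≢v ∘ cong inj₂)))
  union (inj₁ u) (inj₂ v) _ = crossJoins-across P (m (inj₁ u)) (cwLab e u) (m (inj₂ v)) (cwLab f v)
  union (inj₂ u) (inj₁ v) _
    rewrite ∨-comm (crossJoins P (park (tag (m (inj₂ u)) (cwLab f u))) (tag (m (inj₁ v)) (cwLab e v)))
                   (crossJoins P (tag (m (inj₁ v)) (cwLab e v)) (park (tag (m (inj₂ u)) (cwLab f u))))
          | crossJoins-across P (m (inj₁ v)) (cwLab e v) (m (inj₂ u)) (cwLab f u)
          | ∧-comm (m (inj₁ v)) (m (inj₂ u)) | P-sym (cwLab e v) (cwLab f u) = refl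
cwTagged-edge-η : ∀ {k} a b (a≢b : a ≢ b) (e : CWExpr k) m P →
  TaggedEdges e m (P ∪ joins a b) → TaggedEdges (cw-η a b a≢b e) m P
cwTagged-edge-η {k} a b a≢b e m P e-edge {u} {v} u≢v = begin
  cwAdj (joinWhere ι Jη E) (to (joinWhere-vertices ι Jη E) u′) (to (joinWhere-vertices ι Jη E) v′)
    ≡⟨ unmarkedJoins-edge ι isMarked origin a b a≢b E {x = tag (m u) lu} {y = tag (m v) lv}
         (cwTagged-label e m (P ∪ joins a b) u) (cwTagged-label e m (P ∪ joins a b) v)
         (origin-tag (m u) lu) (origin-tag (m v) lv) ⟩
  cwAdj E u′ v′ ∨ (not (isMarked (tag (m u) lu) ∧ isMarked (tag (m v) lv)) ∧ joins a b lu lv)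
    ≡⟨ cong₂ (λ x y → cwAdj E u′ v′ ∨ (not (x ∧ y) ∧ joins a b lu lv))
             (isMarked-tag (m u) lu) (isMarked-tag (m v) lv) ⟩
  cwAdj E u′ v′ ∨ (not (m u ∧ m v) ∧ joins a b lu lv)
    ≡⟨ cong (_∨ (not (m u ∧ m v) ∧ joins a b lu lv)) (e-edge u≢v) ⟩
  (if m u ∧ m v then not (cwAdj e u v ∨ (P lu lv ∨ joins a b lu lv)) else cwAdj e u v)
    ∨ (not (m u ∧ m v) ∧ joins a b lu lv)
    ≡⟨ regroup (m u ∧ m v) (cwAdj e u v) (P lu lv) (joins a b lu lv) ⟩
  (if m u ∧ m v then not ((cwAdj e u v ∨ joins a b lu lv) ∨ P lu lv) else cwAdj e u v ∨ joins a b lu lv) ∎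
  where
  open ≡-Reasoning
  ι = tagLabels k
  lu = cwLab e u
  lv = cwLab e v
  Jη = unmarkedJoins ι isMarked origin a b
  E = cwTagged e m (P ∪ joins a b)
  u′ = to (cwTagged-vertices e m (P ∪ joins a b)) u
  v′ = to (cwTagged-vertices e m (P ∪ joins a b)) v
  regroup : ∀ M E P J →
    (if M then not (E ∨ (P ∨ J)) else E) ∨ (not M ∧ J) ≡ (if M then not ((E ∨ J) ∨ P) else E ∨ J)
  regroup false E     P     J     = refl
  regroup true  true  P     J     = refl
  regroup true  false false false = refl
  regroup true  false false true  = refl
  regroup true  false true  false = refl
  regroup true  false true  true  = refl

cwTagged-edge : ∀ {k} (e : CWExpr k) m P → (∀ c c′ → P c c′ ≡ P c′ c) → TaggedEdges e m P
cwTagged-edge (cw-vert _)      m P P-sym {tt} {tt} u≢v = ⊥-elim (u≢v refl)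
cwTagged-edge (e cw-⊕ f)       m P P-sym =
  cwTagged-edge-⊕ e f m P P-sym (cwTagged-edge e (m ∘ inj₁) P P-sym) (cwTagged-edge f (m ∘ inj₂) P P-sym)
cwTagged-edge {k} (cw-ρ a b _ e) m P P-sym u≢v =
  trans (relabelBy-edge (tagLabels k) (mapOriginal (relabel a b)) _ _ _)
        (cwTagged-edge e m (P on relabel a b) (λ c c′ → P-sym (relabel a b c) (relabel a b c′)) u≢v)
cwTagged-edge (cw-η a b a≢b e) m P P-sym =
  cwTagged-edge-η a b a≢b e m P
    (cwTagged-edge e m (P ∪ joins a b) (λ c c′ → cong₂ _∨_ (P-sym c c′) (joins-sym a b c c′)))

hasNLC-LC-k+k : ∀ {n k} (G : Graph n) x (e : NLCExpr k) → Realizes (nlcAdj e) G → HasNLC (k + k) (LC G x)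
hasNLC-LC-k+k G x e (f , e-edge) =
  Realizes⇒HasNLC (LC G x) (nlcDoubled e mark)
    (realizes-LC G x f e-edge mark (λ _ → refl) (nlcDoubled-vertices e mark) (nlcAdj-irrefl (nlcDoubled e mark))
      (nlcDoubled-edge e mark))
  where mark = adj G x ∘ to f

hasNLC-LC-k+deg : ∀ {n k} (G : Graph n) x (e : NLCExpr k) → Realizes (nlcAdj e) G → HasNLC (k + deg G x) (LC G x)
hasNLC-LC-k+deg G x e (f , e-edge) =
  Realizes⇒HasNLC (LC G x) (nlcIndexed e τ)
    (realizes-LC G x f e-edge (is-just ∘ τ) (neighbourIndex-is-just G x ∘ to f) (nlcIndexed-vertices e τ)
      (nlcAdj-irrefl (nlcIndexed e τ)) (nlcIndexed-edge e τ (IndexInjective-∘ (neighbourIndex-injective G x) f)))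
  where τ = neighbourIndex G x ∘ to f

hasCW-LC-k+deg : ∀ {n k} (G : Graph n) x (e : CWExpr k) → Realizes (cwAdj e) G → HasCW (k + deg G x) (LC G x)
hasCW-LC-k+deg G x e (f , e-edge) =
  Realizes⇒HasCW (LC G x) (cwComplementIndexed e τ)
    (realizes-LC G x f e-edge (is-just ∘ τ) (neighbourIndex-is-just G x ∘ to f) (cwComplementIndexed-vertices e τ)
      (cwAdj-irrefl (cwComplementIndexed e τ))
      (cwComplementIndexed-edge e τ (IndexInjective-∘ (neighbourIndex-injective G x) f)))
  where τ = neighbourIndex G x ∘ to f

hasCW-LC-k+2k : ∀ {n k} (G : Graph n) x (e : CWExpr k) → Realizes (cwAdj e) G → HasCW (k + (k + k)) (LC G x)
hasCW-LC-k+2k {k = k} G x e (f , e-edge) =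
  Realizes⇒HasCW (LC G x) (cwTagged e mark noJoins)
    (realizes-LC G x f e-edge mark (λ _ → refl) (cwTagged-vertices e mark noJoins) (cwAdj-irrefl (cwTagged e mark noJoins))
      λ {u} {v} u≢v → trans (cwTagged-edge e mark noJoins (λ _ _ → refl) u≢v)
                            (if-not-∨-false≡xor (mark u ∧ mark v) (cwAdj e u v)))
  where
  mark = adj G x ∘ to f
  noJoins : Fin k → Fin k → Bool
  noJoins _ _ = false

nlcw-LC : ∀ {n} (G : Graph n) x k → HasNLC k G → NLC≤ (LC G x) (k + (k ⊓ deg G x))
nlcw-LC G x k h with HasNLC⇒Realizes G h | k ≤? deg G x
... | e , r | yes k≤d = k + k , +-monoʳ-≤ k (≤-reflexive (sym (m≤n⇒m⊓n≡m k≤d))) , hasNLC-LC-k+k G x e r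
... | e , r | no k≰d =
  k + deg G x , +-monoʳ-≤ k (≤-reflexive (sym (m≥n⇒m⊓n≡n (≰⇒≥ k≰d)))) , hasNLC-LC-k+deg G x e r

cw-LC : ∀ {n} (G : Graph n) x k → HasCW k G → CW≤ (LC G x) (k + ((2 * k) ⊓ (2 * deg G x)))
cw-LC G x k h with HasCW⇒Realizes G h | deg G x ≤? k
... | e , r | yes d≤k =
  k + deg G x , +-monoʳ-≤ k (⊓-glb (≤-trans d≤k (m≤m+n k _)) (m≤m+n (deg G x) _)) , hasCW-LC-k+deg G x e r
... | e , r | no d≰k =
  k + (k + k) ,
  +-monoʳ-≤ k (≤-trans (≤-reflexive (cong (k +_) (sym (+-identityʳ k))))
                       (⊓-glb ≤-refl (*-monoʳ-≤ 2 (<⇒≤ (≰⇒> d≰k))))) ,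
  hasCW-LC-k+2k G x e r

corollary1 : ∀ {n} (G : Graph n) (x : Fin n) (k : ℕ) →
    (NLCWidth G k → NLC≤ (LC G x) (k + (k ⊓ deg G x)))
    × (CWWidth G k → CW≤ (LC G x) (k + ((2 * k) ⊓ (2 * deg G x))))
corollary1 G x k = nlcw-LC G x k ∘ proj₁ , cw-LC G x k ∘ proj₁
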